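{- If $\Gamma$ is a finite set of formulas and $\psi$ a formula, then $\Gamma\models_{\sf CPL}\psi$ if and only if $\Gamma,\circ p_1,\dots,\circ p_k\models_{\sf BD2}\psi$, where $p_1,\dots,p_k$ are the propositional variables occurring in $\Gamma\cup\{\psi\}$ and $\circ\alpha:=\copyright\alpha\wedge\copyright\copyright\alpha$.
   Context: Let $\mathbf 4=\{1,\mathbf b,\mathbf n,0\}$ be the lattice with $0<\mathbf b<1$, $0<\mathbf n<1$, $\mathbf b,\mathbf n$ incomparable; $\wedge,\vee$ meet and join. The algebra ${\bf A}_{\sf BD2}$ on $\mathbf 4$ over $\{\wedge,\vee,\to,\neg,\copyright\}$ has: $\neg 1=0$, $\neg\mathbf b=\mathbf b$, $\neg\mathbf n=\mathbf n$, $\neg 0=1$; $\copyright 1=1$, $\copyright\mathbf b=0$, $\copyright\mathbf n=\mathbf b$, $\copyright 0=1$; $x\to y=y$ if $x\in\{1,\mathbf b\}$; $0\to y=1$; $\mathbf n\to 1=\mathbf n\to\mathbf n=1$, $\mathbf n\to\mathbf b=\mathbf n\to 0=\mathbf b$. ${\sf BD2}$ is the logic of the matrix $\langle{\bf A}_{\sf BD2},\{1,\mathbf b\}\rangle$ ($\Gamma\models\psi$ iff every valuation designating all of $\Gamma$ designates $\psi$). ${\sf CPL}$ here is classical propositional logic over the same signature, presented as the logic of the submatrix with domain $\{0,1\}$ (a subalgebra of ${\bf A}_{\sf BD2}$) and designated set $\{1\}$. -}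

module Defs where

open import Data.Nat using (ℕ)
open import Data.Bool using (Bool; true; false)
open import Data.List using (List; []; _∷_; _++_; map; concatMap)
open import Data.List.Membership.Propositional using (_∈_)
open import Relation.Binary.PropositionalEquality using (_≡_)

data Four : Set where
  one bb nn zero : Four

_∧₄_ : Four → Four → Four
one ∧₄ y = y
zero ∧₄ y = zero
bb ∧₄ one = bb
bb ∧₄ bb = bb
bb ∧₄ nn = zero
bb ∧₄ zero = zero
nn ∧₄ one = nn
nn ∧₄ bb = zero
nn ∧₄ nn = nn
nn ∧₄ zero = zero

_∨₄_ : Four → Four → Four
one ∨₄ y = one
zero ∨₄ y = y
bb ∨₄ one = one
bb ∨₄ bb = bb
bb ∨₄ nn = one
bb ∨₄ zero = bb
nn ∨₄ one = one
nn ∨₄ bb = one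
nn ∨₄ nn = nn
nn ∨₄ zero = nn

¬₄ : Four → Four
¬₄ one = zero
¬₄ bb = bb
¬₄ nn = nn
¬₄ zero = one

©₄ : Four → Four
©₄ one = one
©₄ bb = zero
©₄ nn = bb
©₄ zero = one

_→₄_ : Four → Four → Four
one →₄ y = y
bb →₄ y = y
zero →₄ y = one
nn →₄ one = one
nn →₄ nn = one
nn →₄ bb = bb
nn →₄ zero = bb

data Formula : Set where
  var  : ℕ → Formula
  _∧′_ : Formula → Formula → Formula
  _∨′_ : Formula → Formula → Formula
  _⇒′_ : Formula → Formula → Formula
  ¬′_  : Formula → Formula
  ©′_  : Formula → Formula

∘′ : Formula → Formula
∘′ α = (©′ α) ∧′ (©′ (©′ α))

eval : (ℕ → Four) → Formula → Four
eval v (var p) = v p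
eval v (φ ∧′ ψ) = eval v φ ∧₄ eval v ψ
eval v (φ ∨′ ψ) = eval v φ ∨₄ eval v ψ
eval v (φ ⇒′ ψ) = eval v φ →₄ eval v ψ
eval v (¬′ φ) = ¬₄ (eval v φ)
eval v (©′ φ) = ©₄ (eval v φ)

data DesBD2 : Four → Set where
  des-one : DesBD2 one
  des-b   : DesBD2 bb

_⊨BD2_ : List Formula → Formula → Set
Γ ⊨BD2 ψ = (v : ℕ → Four) → ((γ : Formula) → γ ∈ Γ → DesBD2 (eval v γ)) → DesBD2 (eval v ψ)

emb : Bool → Four
emb true = one
emb false = zero

-- CPL: logic of the submatrix with domain {0,1} and designated set {1};
-- valuations range over {0,1}, formulas evaluated in A_BD2 (the subalgebra)
_⊨CPL_ : List Formula → Formula → Set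
Γ ⊨CPL ψ = (v : ℕ → Bool) → ((γ : Formula) → γ ∈ Γ → eval (λ p → emb (v p)) γ ≡ one) → eval (λ p → emb (v p)) ψ ≡ one

vars : Formula → List ℕ
vars (var p) = p ∷ []
vars (φ ∧′ ψ) = vars φ ++ vars ψ
vars (φ ∨′ ψ) = vars φ ++ vars ψ
vars (φ ⇒′ ψ) = vars φ ++ vars ψ
vars (¬′ φ) = vars φ
vars (©′ φ) = vars φ

varsAll : List Formula → Formula → List ℕ
varsAll Γ ψ = concatMap vars Γ ++ vars ψ

withCirc : List Formula → Formula → List Formula
withCirc Γ ψ = Γ ++ map (λ p → ∘′ (var p)) (varsAll Γ ψ)

-- {0, 1} is a subalgebra of A_BD2 on which designation means being 1, so classical valuations compute
-- CPL values.  The formula ∘α is designated exactly when α takes a value in {0, 1}: the hypotheses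
-- ∘pᵢ force a BD2 valuation to be classical on every relevant variable, and by the coincidence lemma
-- it then behaves as the classical valuation p ↦ toBool (v p).  Conversely classical valuations
-- designate every ∘pᵢ.
module Submission where

open import Defs
open import Data.Bool using (Bool; true; false; _∧_; _∨_; not)
open import Data.List using (List; concatMap)
open import Data.List.Membership.Propositional using (_∈_; lose)
open import Data.List.Membership.Propositional.Properties
  using (∈-++⁺ˡ; ∈-++⁺ʳ; ∈-++⁻; ∈-map⁺; ∈-map⁻; ∈-concatMap⁺)
open import Data.List.Relation.Unary.Any using (here)
open import Data.Nat using (ℕ)
open import Data.Product using (_,_)
open import Data.Sum using (inj₁; inj₂)
open import Function.Base using (_∘_)
open import Function.Bundles using (_⇔_; mk⇔)
open import Relation.Binary.PropositionalEquality
  using (_≡_; refl; sym; trans; cong; cong₂; subst)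

evalᵇ : (ℕ → Bool) → Formula → Bool
evalᵇ v (var p)  = v p
evalᵇ v (φ ∧′ ψ) = evalᵇ v φ ∧ evalᵇ v ψ
evalᵇ v (φ ∨′ ψ) = evalᵇ v φ ∨ evalᵇ v ψ
evalᵇ v (φ ⇒′ ψ) = not (evalᵇ v φ) ∨ evalᵇ v ψ
evalᵇ v (¬′ φ)   = not (evalᵇ v φ)
evalᵇ v (©′ φ)   = true

emb-∧ : ∀ a b → emb a ∧₄ emb b ≡ emb (a ∧ b)
emb-∧ true  b = refl
emb-∧ false b = refl

emb-∨ : ∀ a b → emb a ∨₄ emb b ≡ emb (a ∨ b)
emb-∨ true  b = refl
emb-∨ false b = refl

emb-→ : ∀ a b → emb a →₄ emb b ≡ emb (not a ∨ b)
emb-→ true  b = refl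
emb-→ false b = refl

emb-¬ : ∀ a → ¬₄ (emb a) ≡ emb (not a)
emb-¬ true  = refl
emb-¬ false = refl

emb-© : ∀ a → ©₄ (emb a) ≡ emb true
emb-© true  = refl
emb-© false = refl

eval-emb : ∀ v φ → eval (emb ∘ v) φ ≡ emb (evalᵇ v φ)
eval-emb v (var p)  = refl
eval-emb v (φ ∧′ ψ) =
  trans (cong₂ _∧₄_ (eval-emb v φ) (eval-emb v ψ)) (emb-∧ (evalᵇ v φ) (evalᵇ v ψ))
eval-emb v (φ ∨′ ψ) =
  trans (cong₂ _∨₄_ (eval-emb v φ) (eval-emb v ψ)) (emb-∨ (evalᵇ v φ) (evalᵇ v ψ))
eval-emb v (φ ⇒′ ψ) =
  trans (cong₂ _→₄_ (eval-emb v φ) (eval-emb v ψ)) (emb-→ (evalᵇ v φ) (evalᵇ v ψ))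
eval-emb v (¬′ φ)   = trans (cong ¬₄ (eval-emb v φ)) (emb-¬ (evalᵇ v φ))
eval-emb v (©′ φ)   = trans (cong ©₄ (eval-emb v φ)) (emb-© (evalᵇ v φ))

emb-designated : ∀ b → DesBD2 (emb b) → emb b ≡ one
emb-designated true  _ = refl
emb-designated false ()

eval-emb-designated : ∀ v φ → DesBD2 (eval (emb ∘ v) φ) → eval (emb ∘ v) φ ≡ one
eval-emb-designated v φ =
  subst (λ x → DesBD2 x → x ≡ one) (sym (eval-emb v φ)) (emb-designated (evalᵇ v φ))

∘-designated-emb : ∀ v φ → DesBD2 (eval (emb ∘ v) (∘′ φ))
∘-designated-emb v φ = subst DesBD2 (sym (eval-emb v (∘′ φ))) des-one

toBool : Four → Bool
toBool one = true
toBool _   = false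

∘-designated⇒classical : ∀ x → DesBD2 (©₄ x ∧₄ ©₄ (©₄ x)) → emb (toBool x) ≡ x
∘-designated⇒classical one  _ = refl
∘-designated⇒classical zero _ = refl

eval-cong-on-vars : ∀ {v w} φ → (∀ {p} → p ∈ vars φ → v p ≡ w p) → eval v φ ≡ eval w φ
eval-cong-on-vars (var p)  v≡w = v≡w (here refl)
eval-cong-on-vars (φ ∧′ ψ) v≡w =
  cong₂ _∧₄_ (eval-cong-on-vars φ (v≡w ∘ ∈-++⁺ˡ)) (eval-cong-on-vars ψ (v≡w ∘ ∈-++⁺ʳ (vars φ)))
eval-cong-on-vars (φ ∨′ ψ) v≡w =
  cong₂ _∨₄_ (eval-cong-on-vars φ (v≡w ∘ ∈-++⁺ˡ)) (eval-cong-on-vars ψ (v≡w ∘ ∈-++⁺ʳ (vars φ)))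
eval-cong-on-vars (φ ⇒′ ψ) v≡w =
  cong₂ _→₄_ (eval-cong-on-vars φ (v≡w ∘ ∈-++⁺ˡ)) (eval-cong-on-vars ψ (v≡w ∘ ∈-++⁺ʳ (vars φ)))
eval-cong-on-vars (¬′ φ)   v≡w = cong ¬₄ (eval-cong-on-vars φ v≡w)
eval-cong-on-vars (©′ φ)   v≡w = cong ©₄ (eval-cong-on-vars φ v≡w)

module _ (Γ : List Formula) (ψ : Formula) where

  premise-vars⊆varsAll : ∀ {γ p} → γ ∈ Γ → p ∈ vars γ → p ∈ varsAll Γ ψ
  premise-vars⊆varsAll γ∈Γ p∈γ = ∈-++⁺ˡ (∈-concatMap⁺ vars (lose γ∈Γ p∈γ))

  conclusion-vars⊆varsAll : ∀ {p} → p ∈ vars ψ → p ∈ varsAll Γ ψ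
  conclusion-vars⊆varsAll = ∈-++⁺ʳ (concatMap vars Γ)

  ∘var∈withCirc : ∀ {p} → p ∈ varsAll Γ ψ → ∘′ (var p) ∈ withCirc Γ ψ
  ∘var∈withCirc = ∈-++⁺ʳ Γ ∘ ∈-map⁺ (∘′ ∘ var)

  withCirc-designated-emb : ∀ v → (∀ γ → γ ∈ Γ → eval (emb ∘ v) γ ≡ one)
                          → ∀ γ → γ ∈ withCirc Γ ψ → DesBD2 (eval (emb ∘ v) γ)
  withCirc-designated-emb v premises γ γ∈ with ∈-++⁻ Γ γ∈
  ... | inj₁ γ∈Γ = subst DesBD2 (sym (premises γ γ∈Γ)) des-one
  ... | inj₂ γ∈∘s with ∈-map⁻ (∘′ ∘ var) γ∈∘s
  ...   | p , _ , refl = ∘-designated-emb v (var p)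

  bd2⇒cpl : withCirc Γ ψ ⊨BD2 ψ → Γ ⊨CPL ψ
  bd2⇒cpl ⊨bd2 v premises =
    eval-emb-designated v ψ (⊨bd2 (emb ∘ v) (withCirc-designated-emb v premises))

  cpl⇒bd2 : Γ ⊨CPL ψ → withCirc Γ ψ ⊨BD2 ψ
  cpl⇒bd2 ⊨cpl v designated = subst DesBD2 (sym ψ≡one) des-one
    where
    w : ℕ → Bool
    w = toBool ∘ v

    classical : ∀ {p} → p ∈ varsAll Γ ψ → emb (w p) ≡ v p
    classical p∈ = ∘-designated⇒classical _ (designated _ (∘var∈withCirc p∈))

    on-classical-reduct : ∀ φ → (∀ {p} → p ∈ vars φ → p ∈ varsAll Γ ψ)
                        → eval v φ ≡ eval (emb ∘ w) φ
    on-classical-reduct φ φ⊆ = eval-cong-on-vars φ (sym ∘ classical ∘ φ⊆)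

    premises : ∀ γ → γ ∈ Γ → eval (emb ∘ w) γ ≡ one
    premises γ γ∈Γ = eval-emb-designated w γ
      (subst DesBD2 (on-classical-reduct γ (premise-vars⊆varsAll γ∈Γ))
                    (designated γ (∈-++⁺ˡ γ∈Γ)))

    ψ≡one : eval v ψ ≡ one
    ψ≡one = trans (on-classical-reduct ψ conclusion-vars⊆varsAll) (⊨cpl w premises)

mainTheorem5 : (Γ : List Formula) (ψ : Formula) → (Γ ⊨CPL ψ) ⇔ (withCirc Γ ψ ⊨BD2 ψ)
mainTheorem5 Γ ψ = mk⇔ (cpl⇒bd2 Γ ψ) (bd2⇒cpl Γ ψ)
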